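{- Let $n>1$ and let $T$ be an alternative tableau of length $n$ with no free row and exactly one free column, i.e. $T\in\mathcal{A}_{0,1}(n)$. Then the top-left cell of $T$ contains a left arrow.
   Context: A shape of length $n$ is a Ferrers diagram in English notation (rows left-justified, stacked from the top), in which empty rows and empty columns are allowed. It is determined by its south-east border, a lattice path of $n$ unit steps, each south or west, from the top-right corner to the bottom-left corner. Each south step is the right end of a row and each west step is the bottom of a column, so the number of rows plus the number of columns is $n$. An alternative tableau is a shape together with a partial filling of its cells by left arrows $\leftarrow$ and up arrows $\uparrow$ such that every cell lying to the left of a left arrow in the same row, and every cell lying above an up arrow in the same column, is empty. Its length is the length of its shape. A free row is a row containing no left arrow; a free column is a column containing no up arrow. $\mathcal{A}_{i,j}(n)$ denotes the set of alternative tableaux of length $n$ with exactly $i$ free rows and $j$ free columns. -}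

module Defs where

open import Data.Nat using (ℕ; zero; suc; _+_)
open import Data.Fin using (Fin; _<_)
open import Data.Vec using (Vec; lookup)
open import Data.Bool using (Bool; true; false; if_then_else_; _∨_)
open import Relation.Binary.PropositionalEquality using (_≡_; _≢_)
open import Data.Product using (_×_)

-- A step of the south-east border, read from the top-right corner
-- to the bottom-left corner.
data Step : Set where
  S W : Step

-- A shape of length n is its border path.
Shape : ℕ → Set
Shape n = Vec Step n

-- Rows are indexed by the positions i of south steps, columns by the
-- positions j of west steps.  The row of S-step i and the column of
-- W-step j meet in a cell of the diagram iff i < j (the west step
-- bounding the column comes after the south step ending the row).
IsCell : ∀ {n} → Shape n → Fin n → Fin n → Set
IsCell λ' i j = (lookup λ' i ≡ S) × (lookup λ' j ≡ W) × (i < j)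

data Content : Set where
  empty left up : Content

-- Along the
-- path, later W steps are further west, so "to the left of (i,j) in
-- its row" means (i,j') with j < j'; "above (i,j) in its column"
-- means (i',j) with i' < i.
record AltTableau (n : ℕ) : Set where
  field
    shape   : Shape n
    fill    : Fin n → Fin n → Content
    inShape : ∀ i j → fill i j ≢ empty → IsCell shape i j
    leftOK  : ∀ i j j' → fill i j ≡ left → j < j' → IsCell shape i j' → fill i j' ≡ empty
    upOK    : ∀ i i' j → fill i j ≡ up → i' < i → IsCell shape i' j → fill i' j ≡ empty
open AltTableau public

anyFin : ∀ {n} → (Fin n → Bool) → Bool
anyFin {zero}  p = false
anyFin {suc n} p = p Fin.zero ∨ anyFin (λ k → p (Fin.suc k))

countFin : ∀ {n} → (Fin n → Bool) → ℕ
countFin {zero}  p = 0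
countFin {suc n} p = (if p Fin.zero then 1 else 0) + countFin (λ k → p (Fin.suc k))

isS : Step → Bool
isS S = true
isS W = false

isW : Step → Bool
isW S = false
isW W = true

isLeft : Content → Bool
isLeft left = true
isLeft _    = false

isUp : Content → Bool
isUp up = true
isUp _  = false

not : Bool → Bool
not true = false
not false = true

isFreeRow : ∀ {n} → AltTableau n → Fin n → Bool
isFreeRow T i = if isS (lookup (shape T) i) then not (anyFin (λ j → isLeft (fill T i j))) else false

isFreeCol : ∀ {n} → AltTableau n → Fin n → Bool
isFreeCol T j = if isW (lookup (shape T) j) then not (anyFin (λ i → isUp (fill T i j))) else false

freeRows freeCols : ∀ {n} → AltTableau n → ℕ
freeRows T = countFin (isFreeRow T)
freeCols T = countFin (isFreeCol T)

InA : (a b n : ℕ) → AltTableau n → Set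
InA a b n T = (freeRows T ≡ a) × (freeCols T ≡ b)

IsTopRow : ∀ {n} → Shape n → Fin n → Set
IsTopRow λ' i = (lookup λ' i ≡ S) × (∀ k → k < i → lookup λ' k ≡ W)

IsLeftCol : ∀ {n} → Shape n → Fin n → Set
IsLeftCol λ' j = (lookup λ' j ≡ W) × (∀ k → j < k → lookup λ' k ≡ S)

module Submission where

-- Let T ∈ A_{0,1}(n) with n ≥ 2.
--  * If the shape has no row, then it has no cell, so every one of the
--    n ≥ 2 positions is a free column, contradicting "exactly one free
--    column".
--  * Otherwise let i be the top row.  Since no row is free, row i holds a
--    left arrow, in some column j₀.  An up arrow in column j₀ would have
--    to lie strictly above row i (an up arrow below would empty (i,j₀)),
--    but there is no row above the top row; so column j₀ is free.
--  * Let j be the leftmost column.  An up arrow at (k,j) would force the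
--    left arrow of row k to lie strictly west of column j, impossible;
--    so column j is free as well.  Uniqueness of the free column gives
--    j₀ = j, i.e. the top-left cell (i,j) holds a left arrow.

open import Defs
open import Data.Nat using (ℕ; zero; suc; pred; s≤s; _<_)
open import Data.Fin using (Fin)
import Data.Fin as F
open import Data.Fin.Properties using (<-cmp)
open import Data.Vec using (lookup)
open import Data.Bool using (Bool; true; false)
open import Data.Empty using (⊥-elim)
open import Data.Product using (Σ; _×_; _,_; proj₁; proj₂)
open import Data.Sum using (_⊎_; inj₁; inj₂)
open import Relation.Nullary using (¬_; Dec; yes; no)
open import Relation.Binary using (tri<; tri≈; tri>)
open import Relation.Binary.PropositionalEquality
  using (_≡_; _≢_; refl; sym; trans; cong)

firstWhere : ∀ {n} (P : Fin n → Set) → (∀ k → Dec (P k)) →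
  (∀ k → ¬ P k) ⊎ Σ (Fin n) λ i → P i × (∀ k → k F.< i → ¬ P k)
firstWhere {zero} P P? = inj₁ (λ ())
firstWhere {suc n} P P? with P? F.zero
... | yes p0 = inj₂ (F.zero , p0 , λ k ())
... | no ¬p0 with firstWhere (λ k → P (F.suc k)) (λ k → P? (F.suc k))
...   | inj₁ none = inj₁ λ { F.zero → ¬p0 ; (F.suc k) → none k }
...   | inj₂ (i , pi , least) =
        inj₂ (F.suc i , pi , λ { F.zero _ → ¬p0 ; (F.suc k) (s≤s k<i) → least k k<i })

lastWhere : ∀ {n} (P : Fin n → Set) → (∀ k → Dec (P k)) →
  (∀ k → ¬ P k) ⊎ Σ (Fin n) λ i → P i × (∀ k → i F.< k → ¬ P k)
lastWhere {zero} P P? = inj₁ (λ ())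
lastWhere {suc n} P P? with lastWhere (λ k → P (F.suc k)) (λ k → P? (F.suc k))
... | inj₂ (i , pi , greatest) =
      inj₂ (F.suc i , pi , λ { F.zero () ; (F.suc k) (s≤s i<k) → greatest k i<k })
... | inj₁ none with P? F.zero
...   | yes p0 = inj₂ (F.zero , p0 , λ { F.zero () ; (F.suc k) _ → none k })
...   | no ¬p0 = inj₁ λ { F.zero → ¬p0 ; (F.suc k) → none k }

_≟S : (s : Step) → Dec (s ≡ S)
S ≟S = yes refl
W ≟S = no λ ()

_≟W : (s : Step) → Dec (s ≡ W)
W ≟W = yes refl
S ≟W = no λ ()

≢S⇒≡W : ∀ {s} → s ≢ S → s ≡ W
≢S⇒≡W {S} s≢S = ⊥-elim (s≢S refl)
≢S⇒≡W {W} _   = refl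

≢W⇒≡S : ∀ {s} → s ≢ W → s ≡ S
≢W⇒≡S {W} s≢W = ⊥-elim (s≢W refl)
≢W⇒≡S {S} _   = refl

S≢W : S ≢ W
S≢W ()

topRow : ∀ {n} (sh : Shape n) →
  (∀ k → lookup sh k ≡ W) ⊎ Σ (Fin n) (IsTopRow sh)
topRow sh with firstWhere (λ k → lookup sh k ≡ S) (λ k → lookup sh k ≟S)
... | inj₁ none = inj₁ λ k → ≢S⇒≡W (none k)
... | inj₂ (i , si , least) = inj₂ (i , si , λ k k<i → ≢S⇒≡W (least k k<i))

leftCol : ∀ {n} (sh : Shape n) (j₀ : Fin n) → lookup sh j₀ ≡ W →
  Σ (Fin n) (IsLeftCol sh)
leftCol sh j₀ wj₀ with lastWhere (λ k → lookup sh k ≡ W) (λ k → lookup sh k ≟W)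
... | inj₁ none = ⊥-elim (none j₀ wj₀)
... | inj₂ (j , wj , greatest) = j , wj , λ k j<k → ≢W⇒≡S (greatest k j<k)

anyFin-witness : ∀ {n} (p : Fin n → Bool) → anyFin p ≡ true →
  Σ (Fin n) λ k → p k ≡ true
anyFin-witness {zero} p ()
anyFin-witness {suc n} p any with p F.zero in p0
... | true  = F.zero , p0
... | false with anyFin-witness (λ k → p (F.suc k)) any
...   | k , pk = F.suc k , pk

anyFin-none : ∀ {n} (p : Fin n → Bool) → (∀ k → p k ≡ false) → anyFin p ≡ false
anyFin-none {zero} p none = refl
anyFin-none {suc n} p none rewrite none F.zero =
  anyFin-none (λ k → p (F.suc k)) (λ k → none (F.suc k))

countFin≡0 : ∀ {n} (p : Fin n → Bool) → countFin p ≡ 0 → ∀ k → p k ≡ false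
countFin≡0 {suc n} p c k with p F.zero in p0
countFin≡0 {suc n} p ()  k         | true
countFin≡0 {suc n} p c F.zero      | false = p0
countFin≡0 {suc n} p c (F.suc k)   | false = countFin≡0 (λ k → p (F.suc k)) c k

countFin≡1 : ∀ {n} (p : Fin n → Bool) → countFin p ≡ 1 →
  ∀ a b → p a ≡ true → p b ≡ true → a ≡ b
countFin≡1 {suc n} p c a b pa pb with p F.zero in p0
... | true  = unique a b pa pb
  where
  restFalse : ∀ k → p (F.suc k) ≡ false
  restFalse = countFin≡0 (λ k → p (F.suc k)) (cong pred c)
  unique : ∀ a b → p a ≡ true → p b ≡ true → a ≡ b
  unique F.zero    F.zero    _  _  = refl
  unique F.zero    (F.suc b) _  pb with () ← trans (sym (restFalse b)) pb
  unique (F.suc a) _         pa _  with () ← trans (sym (restFalse a)) pa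
... | false = unique a b pa pb
  where
  unique : ∀ a b → p a ≡ true → p b ≡ true → a ≡ b
  unique F.zero    _         pa _  with () ← trans (sym p0) pa
  unique (F.suc a) F.zero    _  pb with () ← trans (sym p0) pb
  unique (F.suc a) (F.suc b) pa pb =
    cong F.suc (countFin≡1 (λ k → p (F.suc k)) c a b pa pb)

isLeft⇒left : ∀ {c} → isLeft c ≡ true → c ≡ left
isLeft⇒left {left} _ = refl

≢up⇒notUp : ∀ {c} → c ≢ up → isUp c ≡ false
≢up⇒notUp {empty} _ = refl
≢up⇒notUp {left}  _ = refl
≢up⇒notUp {up} c≢up = ⊥-elim (c≢up refl)

module _ {n} (T : AltTableau n) where

  left⇒cell : ∀ {i j} → fill T i j ≡ left → IsCell (shape T) i j
  left⇒cell l = inShape T _ _ λ e → case (trans (sym l) e)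
    where case : left ≢ empty
          case ()

  up⇒cell : ∀ {i j} → fill T i j ≡ up → IsCell (shape T) i j
  up⇒cell u = inShape T _ _ λ e → case (trans (sym u) e)
    where case : up ≢ empty
          case ()

  left≢up : ∀ {i j} → fill T i j ≡ left → fill T i j ≢ up
  left≢up l u with () ← trans (sym l) u

  -- An up arrow in the column of a left arrow lies strictly above it:
  -- below, it would empty the cell of the left arrow.
  up-above-left : ∀ {i k j} → fill T i j ≡ left → fill T k j ≡ up → k F.< i
  up-above-left {i} {k} l u with <-cmp k i
  ... | tri< k<i _ _ = k<i
  ... | tri≈ _ refl _ = ⊥-elim (left≢up l u)
  ... | tri> _ _ i<k with () ← trans (sym l) (upOK T k i _ u i<k (left⇒cell l))

  -- A left arrow in the row of an up arrow lies strictly west of it: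
  -- to the east, it would empty the cell of the up arrow.
  left-west-of-up : ∀ {k j j₁} → fill T k j ≡ up → fill T k j₁ ≡ left → j F.< j₁
  left-west-of-up {k} {j} {j₁} u l with <-cmp j₁ j
  ... | tri> _ _ j<j₁ = j<j₁
  ... | tri≈ _ refl _ = ⊥-elim (left≢up l u)
  ... | tri< j₁<j _ _ with () ← trans (sym u) (leftOK T k j₁ j l j₁<j (up⇒cell u))

  noFreeRow⇒left : freeRows T ≡ 0 → ∀ r → lookup (shape T) r ≡ S →
    Σ (Fin n) λ j → fill T r j ≡ left
  noFreeRow⇒left fr r sr with anyFin (λ j → isLeft (fill T r j)) in hasLeft
                            | countFin≡0 (isFreeRow T) fr r
  ... | true  | _ with j , isl ← anyFin-witness _ hasLeft = j , isLeft⇒left isl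
  ... | false | notFree rewrite sr with () ← notFree

  noUp⇒freeCol : ∀ j → lookup (shape T) j ≡ W → (∀ k → fill T k j ≢ up) →
    isFreeCol T j ≡ true
  noUp⇒freeCol j wj noUp rewrite wj | anyFin-none _ (λ k → ≢up⇒notUp (noUp k)) = refl

  noRow⇒freeCol : (∀ k → lookup (shape T) k ≡ W) → ∀ j → isFreeCol T j ≡ true
  noRow⇒freeCol allW j = noUp⇒freeCol j (allW j) λ k u →
    S≢W (trans (sym (proj₁ (up⇒cell u))) (allW k))

  topRowLeft⇒freeCol : ∀ {i j} → IsTopRow (shape T) i → fill T i j ≡ left →
    isFreeCol T j ≡ true
  topRowLeft⇒freeCol (_ , aboveW) l =
    noUp⇒freeCol _ (proj₁ (proj₂ (left⇒cell l))) λ k u →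
      S≢W (trans (sym (proj₁ (up⇒cell u))) (aboveW k (up-above-left l u)))

  leftCol⇒freeCol : freeRows T ≡ 0 → ∀ {j} → IsLeftCol (shape T) j →
    isFreeCol T j ≡ true
  leftCol⇒freeCol fr {j} (wj , westS) = noUp⇒freeCol j wj λ k u →
    let (j₁ , l) = noFreeRow⇒left fr k (proj₁ (up⇒cell u))
    in S≢W (trans (sym (westS j₁ (left-west-of-up u l))) (proj₁ (proj₂ (left⇒cell l))))

proposition2p3 : (n : ℕ) → 1 < n → (T : AltTableau n) → InA 0 1 n T →
    Σ (Fin n) λ i → Σ (Fin n) λ j →
      IsTopRow (shape T) i × IsLeftCol (shape T) j × IsCell (shape T) i j × (fill T i j ≡ left)
proposition2p3 (suc zero) (s≤s ()) T _
proposition2p3 (suc (suc m)) _ T (fr , fc) with topRow (shape T)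
... | inj₁ noRow with () ← countFin≡1 (isFreeCol T) fc F.zero (F.suc F.zero)
                             (noRow⇒freeCol T noRow F.zero)
                             (noRow⇒freeCol T noRow (F.suc F.zero))
... | inj₂ (i , top)
    with j₀ , l ← noFreeRow⇒left T fr i (proj₁ top)
    with j , lc ← leftCol (shape T) j₀ (proj₁ (proj₂ (left⇒cell T l)))
    with refl ← countFin≡1 (isFreeCol T) fc j₀ j
                  (topRowLeft⇒freeCol T top l) (leftCol⇒freeCol T fr lc)
    = i , j , top , lc , left⇒cell T l , l
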